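{- Let $\mathcal Q$ be a quasivariety in a finite language with the Fraser–Horn property, and assume its free algebra $\mathbf F$ of countably infinite rank has a finite $\mathcal Q$-simple subalgebra $\mathbf C$. If $\mathcal Q$ is almost structurally complete, then for every finite $\mathcal Q$-subdirectly irreducible algebra $\mathbf S$, either $\mathbf S$ embeds into $\mathbf F$ or $\mathbf S\times\mathbf C$ embeds into $\mathbf F$.
   Context: A congruence $\alpha$ of $\mathbf A$ is a $\mathcal Q$-congruence if $\mathbf A/\alpha\in\mathcal Q$. $\mathcal Q$ has the Fraser–Horn property if for all algebras $\mathbf A,\mathbf B$ every $\mathcal Q$-congruence of $\mathbf A\times\mathbf B$ is of the form $\alpha\times\beta=\{((a_1,b_1),(a_2,b_2)):(a_1,a_2)\in\alpha,(b_1,b_2)\in\beta\}$ with $\alpha$ a $\mathcal Q$-congruence of $\mathbf A$ and $\beta$ of $\mathbf B$. A nontrivial algebra is $\mathcal Q$-simple if its only $\mathcal Q$-congruences are equality and the total relation; a nontrivial $\mathbf S\in\mathcal Q$ is $\mathcal Q$-subdirectly irreducible if equality is completely meet-irreducible in its lattice of $\mathcal Q$-congruences. For a quasi-identity $q=(\forall\bar x)[\varphi\to\psi]$ let $q^*=(\forall\bar x)\neg\varphi$; $q$ true in $\mathbf F$ is $\mathcal Q$-active if $q^*$ fails in $\mathbf F$; $\mathcal Q$ is almost structurally complete if every $\mathcal Q$-active quasi-identity holds in $\mathcal Q$. -}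

module Defs where

open import Level using (0ℓ) renaming (suc to lsuc)
open import Data.Nat using (ℕ)
open import Data.Fin using (Fin)
open import Data.List using (List)
open import Data.List.Relation.Unary.All using (All)
open import Data.Product using (Σ; _×_; _,_; proj₁; proj₂; ∃; ∃-syntax)
open import Data.Sum using (_⊎_)
open import Relation.Nullary using (¬_)
open import Relation.Binary using (IsEquivalence)

record Signature : Set where
  field
    nOps  : ℕ
    arity : Fin nOps → ℕ

open Signature public

-- Algebras (setoid-based: the equality of the algebra is _≈_).
-- Universes of algebras are nonempty (as usual in universal algebra).

record Algebra (σ : Signature) : Set₁ where
  field
    Carrier    : Set
    _≈_        : Carrier → Carrier → Set
    isEquiv    : IsEquivalence _≈_
    op         : (f : Fin (nOps σ)) → (Fin (arity σ f) → Carrier) → Carrier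
    op-cong    : ∀ f {xs ys : Fin (arity σ f) → Carrier} →
                 (∀ i → xs i ≈ ys i) → op f xs ≈ op f ys
    inhabitant : Carrier

open Algebra public

data Term (σ : Signature) (X : Set) : Set where
  var : X → Term σ X
  app : (f : Fin (nOps σ)) → (Fin (arity σ f) → Term σ X) → Term σ X

module _ {σ : Signature} where

  eval : (A : Algebra σ) {X : Set} → (X → Carrier A) → Term σ X → Carrier A
  eval A ρ (var x)    = ρ x
  eval A ρ (app f ts) = op A f (λ i → eval A ρ (ts i))

  substT : {X Y : Set} → (X → Term σ Y) → Term σ X → Term σ Y
  substT θ (var x)    = θ x
  substT θ (app f ts) = app f (λ i → substT θ (ts i))

Equation : Signature → Set
Equation σ = Term σ ℕ × Term σ ℕ

record QuasiIdentity (σ : Signature) : Set where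
  constructor _⇒_
  field
    premises   : List (Equation σ)
    conclusion : Equation σ

open QuasiIdentity public

module _ {σ : Signature} where

  Holds : (A : Algebra σ) → (ℕ → Carrier A) → Equation σ → Set
  Holds A ρ (s , t) = _≈_ A (eval A ρ s) (eval A ρ t)

  _⊨_ : Algebra σ → QuasiIdentity σ → Set
  A ⊨ q = ∀ (ρ : ℕ → Carrier A) →
          All (Holds A ρ) (premises q) → Holds A ρ (conclusion q)

  _⊨*_ : Algebra σ → QuasiIdentity σ → Set
  A ⊨* q = ∀ (ρ : ℕ → Carrier A) → ¬ All (Holds A ρ) (premises q)

-- A quasivariety is given by a set of quasi-identities axiomatizing it;
-- its members are the models of those quasi-identities.

Quasivariety : Signature → Set₁
Quasivariety σ = QuasiIdentity σ → Set

module _ {σ : Signature} where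

  _∈_ : Algebra σ → Quasivariety σ → Set
  A ∈ Q = ∀ q → Q q → A ⊨ q

  _⊫_ : Quasivariety σ → QuasiIdentity σ → Set₁
  Q ⊫ q = ∀ (A : Algebra σ) → A ∈ Q → A ⊨ q

-- The Q-free algebra of countably infinite rank:  T(ω)/θ_Q  where θ_Q is
-- the least congruence of the term algebra T(ω) whose quotient lies in Q,
-- i.e. the least congruence closed under all substitution instances of
-- the axioms of Q.

module _ {σ : Signature} (Q : Quasivariety σ) where

  data _≈F_ : Term σ ℕ → Term σ ℕ → Set where
    F-refl  : ∀ {s} → s ≈F s
    F-sym   : ∀ {s t} → s ≈F t → t ≈F s
    F-trans : ∀ {s t u} → s ≈F t → t ≈F u → s ≈F u
    F-cong  : ∀ f {ss ts : Fin (arity σ f) → Term σ ℕ} →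
              (∀ i → ss i ≈F ts i) → app f ss ≈F app f ts
    F-ax    : ∀ q → Q q → (θ : ℕ → Term σ ℕ) →
              All (λ e → substT θ (proj₁ e) ≈F substT θ (proj₂ e)) (premises q) →
              substT θ (proj₁ (conclusion q)) ≈F substT θ (proj₂ (conclusion q))

  Free : Algebra σ
  Free = record
    { Carrier    = Term σ ℕ
    ; _≈_        = _≈F_
    ; isEquiv    = record { refl = F-refl ; sym = F-sym ; trans = F-trans }
    ; op         = app
    ; op-cong    = F-cong
    ; inhabitant = var 0
    }

module _ {σ : Signature} where

  record Congruence (A : Algebra σ) : Set₁ where
    field
      rel     : Carrier A → Carrier A → Set
      isEquiv : IsEquivalence rel
      ≈⊆rel   : ∀ {a b} → _≈_ A a b → rel a b
      compat  : ∀ f {xs ys : Fin (arity σ f) → Carrier A} →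
                (∀ i → rel (xs i) (ys i)) → rel (op A f xs) (op A f ys)

  open Congruence public

  _/_ : (A : Algebra σ) → Congruence A → Algebra σ
  A / θ = record
    { Carrier    = Carrier A
    ; _≈_        = rel θ
    ; isEquiv    = Congruence.isEquiv θ
    ; op         = op A
    ; op-cong    = compat θ
    ; inhabitant = inhabitant A
    }

  QCong : Quasivariety σ → Algebra σ → Set₁
  QCong Q A = Σ (Congruence A) (λ α → (A / α) ∈ Q)

  _×A_ : Algebra σ → Algebra σ → Algebra σ
  A ×A B = record
    { Carrier    = Carrier A × Carrier B
    ; _≈_        = λ x y → _≈_ A (proj₁ x) (proj₁ y) × _≈_ B (proj₂ x) (proj₂ y)
    ; isEquiv    = record
        { refl  = IsEquivalence.refl (isEquiv A) , IsEquivalence.refl (isEquiv B)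
        ; sym   = λ p → IsEquivalence.sym (isEquiv A) (proj₁ p) ,
                        IsEquivalence.sym (isEquiv B) (proj₂ p)
        ; trans = λ p q → IsEquivalence.trans (isEquiv A) (proj₁ p) (proj₁ q) ,
                          IsEquivalence.trans (isEquiv B) (proj₂ p) (proj₂ q) }
    ; op         = λ f xs → op A f (λ i → proj₁ (xs i)) , op B f (λ i → proj₂ (xs i))
    ; op-cong    = λ f p → op-cong A f (λ i → proj₁ (p i)) , op-cong B f (λ i → proj₂ (p i))
    ; inhabitant = inhabitant A , inhabitant B
    }

  FraserHorn : Quasivariety σ → Set₁
  FraserHorn Q =
    ∀ (A B : Algebra σ) (θ : QCong Q (A ×A B)) →
      Σ (QCong Q A) λ α → Σ (QCong Q B) λ β →
        ∀ (x y : Carrier (A ×A B)) →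
          (rel (proj₁ θ) x y → rel (proj₁ α) (proj₁ x) (proj₁ y) × rel (proj₁ β) (proj₂ x) (proj₂ y))
        × (rel (proj₁ α) (proj₁ x) (proj₁ y) × rel (proj₁ β) (proj₂ x) (proj₂ y) → rel (proj₁ θ) x y)

  Nontrivial : Algebra σ → Set
  Nontrivial A = ∃[ a ] ∃[ b ] ¬ (_≈_ A a b)

  IsEquality : (A : Algebra σ) → Congruence A → Set
  IsEquality A α = ∀ a b → rel α a b → _≈_ A a b

  IsTotal : (A : Algebra σ) → Congruence A → Set
  IsTotal A α = ∀ a b → rel α a b

  QSimple : Quasivariety σ → Algebra σ → Set₁
  QSimple Q A = Nontrivial A ×
    (∀ (α : QCong Q A) → IsEquality A (proj₁ α) ⊎ IsTotal A (proj₁ α))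

  -- equality completely meet-irreducible in the lattice of Q-congruences
  -- (meets there are intersections): whenever a family of Q-congruences
  -- has intersection equal to the equality, one member is the equality.
  QSubdirectlyIrreducible : Quasivariety σ → Algebra σ → Set₁
  QSubdirectlyIrreducible Q S = S ∈ Q × Nontrivial S ×
    (∀ (I : Set) (α : I → QCong Q S) →
       (∀ a b → (∀ i → rel (proj₁ (α i)) a b) → _≈_ S a b) →
       ∃[ i ] IsEquality S (proj₁ (α i)))

  Finite : Algebra σ → Set
  Finite A = ∃[ n ] Σ (Fin n → Carrier A) λ e → ∀ a → ∃[ i ] _≈_ A (e i) a

  record Embedding (A B : Algebra σ) : Set where
    field
      map     : Carrier A → Carrier B
      map-cong : ∀ {a b} → _≈_ A a b → _≈_ B (map a) (map b)
      map-inj : ∀ {a b} → _≈_ B (map a) (map b) → _≈_ A a b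
      map-hom : ∀ f (xs : Fin (arity σ f) → Carrier A) →
                _≈_ B (map (op A f xs)) (op B f (λ i → map (xs i)))

  record Subuniverse (A : Algebra σ) : Set₁ where
    field
      member  : Carrier A → Set
      closed  : ∀ f (xs : Fin (arity σ f) → Carrier A) →
                (∀ i → member (xs i)) → member (op A f xs)
      witness : Σ (Carrier A) member

  open Subuniverse public

  SubAlg : (A : Algebra σ) → Subuniverse A → Algebra σ
  SubAlg A U = record
    { Carrier    = Σ (Carrier A) (member U)
    ; _≈_        = λ x y → _≈_ A (proj₁ x) (proj₁ y)
    ; isEquiv    = record
        { refl  = IsEquivalence.refl (isEquiv A)
        ; sym   = IsEquivalence.sym (isEquiv A)
        ; trans = IsEquivalence.trans (isEquiv A) }
    ; op         = λ f xs → op A f (λ i → proj₁ (xs i)) ,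
                            closed U f (λ i → proj₁ (xs i)) (λ i → proj₂ (xs i))
    ; op-cong    = λ f p → op-cong A f p
    ; inhabitant = witness U
    }

  -- almost structural completeness: every Q-active quasi-identity
  -- (true in F, with q* failing in F) holds in Q.
  AlmostStructurallyComplete : Quasivariety σ → Set₁
  AlmostStructurallyComplete Q =
    ∀ (q : QuasiIdentity σ) → Free Q ⊨ q → ¬ (Free Q ⊨* q) → Q ⊫ q

-- Let P = S × C. For a ≉ b in S consider the quasi-identity "diagram of P ⇒ x(a,c₀) ≈ x(b,c₀)".
-- It fails in P ∈ Q, and its premises are satisfiable in F (send (s , c) to c), so by almost
-- structural completeness it fails in F: some homomorphism h : P → F separates (a,c₀) from
-- (b,c₀). The kernel of h is a Q-congruence, hence by Fraser–Horn of the form α × β with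
-- (a , b) ∉ α. These α's intersect to the equality of S, so by Q-subdirect irreducibility one
-- of them is the equality; as C is Q-simple its β is the equality (h embeds S × C) or total
-- (s ↦ h (s , c₀) embeds S).
module Submission where

open import Defs
open import Level using (0ℓ; lift; lower) renaming (suc to lsuc)
open import Axiom.ExcludedMiddle using (ExcludedMiddle)
open import Data.Nat using (ℕ; zero; suc; _*_)
open import Data.Fin using (Fin; zero; suc; toℕ; combine; remQuot; finToFun; funToFin)
open import Data.Fin.Properties using (remQuot-combine; finToFun-funToFin)
open import Data.List using (List; []; _∷_; _++_; concat; tabulate)
open import Data.List.Relation.Unary.All as All using (All; []; _∷_)
open import Data.List.Relation.Unary.All.Properties
  using (++⁺; ++⁻ˡ; ++⁻ʳ; concat⁺; concat⁻; tabulate⁺; tabulate⁻)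
open import Data.Product as Product using (Σ; _×_; _,_; proj₁; proj₂)
open import Data.Sum using (_⊎_; inj₁; inj₂; [_,_]′)
open import Function using (_∘_)
open import Relation.Nullary using (¬_; Dec; yes; no; contradiction)
open import Relation.Nullary.Decidable using (map′; decidable-stable)
open import Relation.Binary using (IsEquivalence; Setoid; Decidable)
open import Relation.Binary.PropositionalEquality as ≡ using (_≡_; refl)
import Relation.Binary.Reasoning.Setoid as SetoidReasoning

module _ (lem : ExcludedMiddle (lsuc 0ℓ)) where

  decide : (X : Set) → Dec X
  decide X = map′ lower lift lem

  ¬¬-elim : {X : Set} → ¬ ¬ X → X
  ¬¬-elim {X} = decidable-stable (decide X)

  ¬⊨⇒counterexample : {σ : Signature} (A : Algebra σ) (q : QuasiIdentity σ) → ¬ (A ⊨ q) →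
                      Σ (ℕ → Carrier A) λ ρ →
                        All (Holds A ρ) (premises q) × ¬ Holds A ρ (conclusion q)
  ¬⊨⇒counterexample A q A⊭q =
    ¬¬-elim λ none → A⊭q λ ρ ps → ¬¬-elim λ fails → none (ρ , ps , fails)

when : {X Y : Set} → Dec X → Y → List Y
when (yes _) y = y ∷ []
when (no _)  y = []

module _ {X Y : Set} {P : Y → Set} {y : Y} where

  All-when⁺ : (d : Dec X) → (X → P y) → All P (when d y)
  All-when⁺ (yes x) p = p x ∷ []
  All-when⁺ (no _)  p = []

  All-when⁻ : (d : Dec X) → All P (when d y) → X → P y
  All-when⁻ (yes _) (py ∷ []) _ = py
  All-when⁻ (no ¬x) []        x = contradiction x ¬x

extend : {X : Set} {n : ℕ} → (Fin n → X) → X → ℕ → X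
extend {n = zero}  g d k       = d
extend {n = suc n} g d zero    = g zero
extend {n = suc n} g d (suc k) = extend (g ∘ suc) d k

extend-toℕ : {X : Set} {n : ℕ} (g : Fin n → X) (d : X) (i : Fin n) → extend g d (toℕ i) ≡ g i
extend-toℕ g d zero    = refl
extend-toℕ g d (suc i) = extend-toℕ (g ∘ suc) d i

module _ {σ : Signature} where

  setoid : Algebra σ → Setoid 0ℓ 0ℓ
  setoid A = record { Carrier = Carrier A ; _≈_ = _≈_ A ; isEquivalence = isEquiv A }

  module _ (A : Algebra σ) where
    open Setoid (setoid A) public
      using () renaming (refl to ≈-refl; sym to ≈-sym; trans to ≈-trans; reflexive to ≈-reflexive)

  record Hom (A B : Algebra σ) : Set where
    field
      ⟦_⟧     : Carrier A → Carrier B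
      ⟦⟧-cong : ∀ {a b} → _≈_ A a b → _≈_ B (⟦_⟧ a) (⟦_⟧ b)
      ⟦⟧-homo : ∀ f (xs : Fin (arity σ f) → Carrier A) →
                _≈_ B (⟦_⟧ (op A f xs)) (op B f (⟦_⟧ ∘ xs))

  open Hom public

  IsInjective : {A B : Algebra σ} → Hom A B → Set
  IsInjective {A} {B} h = ∀ {a b} → _≈_ B (⟦ h ⟧ a) (⟦ h ⟧ b) → _≈_ A a b

  idʰ : {A : Algebra σ} → Hom A A
  idʰ {A} = record { ⟦_⟧ = λ a → a ; ⟦⟧-cong = λ p → p ; ⟦⟧-homo = λ f xs → ≈-refl A }

  _∘ʰ_ : {A B C : Algebra σ} → Hom B C → Hom A B → Hom A C
  _∘ʰ_ {C = C} g h = record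
    { ⟦_⟧     = ⟦ g ⟧ ∘ ⟦ h ⟧
    ; ⟦⟧-cong = ⟦⟧-cong g ∘ ⟦⟧-cong h
    ; ⟦⟧-homo = λ f xs → ≈-trans C (⟦⟧-cong g (⟦⟧-homo h f xs)) (⟦⟧-homo g f _)
    }

  proj₁ʰ : {A B : Algebra σ} → Hom (A ×A B) A
  proj₁ʰ {A} = record { ⟦_⟧ = proj₁ ; ⟦⟧-cong = proj₁ ; ⟦⟧-homo = λ f xs → ≈-refl A }

  proj₂ʰ : {A B : Algebra σ} → Hom (A ×A B) B
  proj₂ʰ {B = B} = record { ⟦_⟧ = proj₂ ; ⟦⟧-cong = proj₂ ; ⟦⟧-homo = λ f xs → ≈-refl B }

  inclusionʰ : {A : Algebra σ} (U : Subuniverse A) → Hom (SubAlg A U) A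
  inclusionʰ {A} U = record { ⟦_⟧ = proj₁ ; ⟦⟧-cong = λ p → p ; ⟦⟧-homo = λ f xs → ≈-refl A }

  kernel : {A B : Algebra σ} → Hom A B → Congruence A
  kernel {A} {B} h = record
    { rel     = λ a b → _≈_ B (⟦ h ⟧ a) (⟦ h ⟧ b)
    ; isEquiv = record { refl = ≈-refl B ; sym = ≈-sym B ; trans = ≈-trans B }
    ; ≈⊆rel   = ⟦⟧-cong h
    ; compat  = λ f {xs} {ys} ps →
        ≈-trans B (⟦⟧-homo h f xs) (≈-trans B (op-cong B f ps) (≈-sym B (⟦⟧-homo h f ys)))
    }

  quotientʰ : {A B : Algebra σ} (h : Hom A B) → Hom (A / kernel h) B
  quotientʰ h = record { ⟦_⟧ = ⟦ h ⟧ ; ⟦⟧-cong = λ p → p ; ⟦⟧-homo = ⟦⟧-homo h }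

  ⟦⟧-eval : {A B : Algebra σ} (h : Hom A B) (ρ : ℕ → Carrier A) (t : Term σ ℕ) →
            _≈_ B (⟦ h ⟧ (eval A ρ t)) (eval B (⟦ h ⟧ ∘ ρ) t)
  ⟦⟧-eval {B = B} h ρ (var x)    = ≈-refl B
  ⟦⟧-eval {B = B} h ρ (app f ts) =
    ≈-trans B (⟦⟧-homo h f _) (op-cong B f (λ i → ⟦⟧-eval h ρ (ts i)))

  module _ {A B : Algebra σ} (h : Hom A B) {ρ : ℕ → Carrier A} where

    Holds-∘⁺ : {e : Equation σ} → _≈_ B (⟦ h ⟧ (eval A ρ (proj₁ e))) (⟦ h ⟧ (eval A ρ (proj₂ e))) →
               Holds B (⟦ h ⟧ ∘ ρ) e
    Holds-∘⁺ {s , t} p = ≈-trans B (≈-sym B (⟦⟧-eval h ρ s)) (≈-trans B p (⟦⟧-eval h ρ t))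

    Holds-∘⁻ : {e : Equation σ} → Holds B (⟦ h ⟧ ∘ ρ) e →
               _≈_ B (⟦ h ⟧ (eval A ρ (proj₁ e))) (⟦ h ⟧ (eval A ρ (proj₂ e)))
    Holds-∘⁻ {s , t} p = ≈-trans B (⟦⟧-eval h ρ s) (≈-trans B p (≈-sym B (⟦⟧-eval h ρ t)))

    All-Holds-⟦⟧ : {es : List (Equation σ)} → All (Holds A ρ) es → All (Holds B (⟦ h ⟧ ∘ ρ)) es
    All-Holds-⟦⟧ = All.map λ {e} p → Holds-∘⁺ {e} (⟦⟧-cong h p)

  module _ {Q : Quasivariety σ} where

    ∈-reflect : {A B : Algebra σ} (h : Hom A B) → IsInjective h → B ∈ Q → A ∈ Q
    ∈-reflect h inj B∈Q q q∈Q ρ ps =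
      inj (Holds-∘⁻ h {ρ} {conclusion q} (B∈Q q q∈Q (⟦ h ⟧ ∘ ρ) (All-Holds-⟦⟧ h ps)))

    ×-∈ : {A B : Algebra σ} → A ∈ Q → B ∈ Q → (A ×A B) ∈ Q
    ×-∈ {A} {B} A∈Q B∈Q q q∈Q ρ ps =
      Holds-∘⁻ (proj₁ʰ {A} {B}) {ρ} {conclusion q} (A∈Q q q∈Q (proj₁ ∘ ρ) (All-Holds-⟦⟧ (proj₁ʰ {A} {B}) ps)) ,
      Holds-∘⁻ (proj₂ʰ {A} {B}) {ρ} {conclusion q} (B∈Q q q∈Q (proj₂ ∘ ρ) (All-Holds-⟦⟧ (proj₂ʰ {A} {B}) ps))

    SubAlg-∈ : {A : Algebra σ} (U : Subuniverse A) → A ∈ Q → SubAlg A U ∈ Q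
    SubAlg-∈ U = ∈-reflect (inclusionʰ U) (λ p → p)

    kernel-∈ : {A B : Algebra σ} → B ∈ Q → (h : Hom A B) → (A / kernel h) ∈ Q
    kernel-∈ B∈Q h = ∈-reflect (quotientʰ h) (λ p → p) B∈Q

    eval-Free : (ρ : ℕ → Term σ ℕ) (t : Term σ ℕ) → _≈F_ Q (eval (Free Q) ρ t) (substT ρ t)
    eval-Free ρ (var x)    = F-refl
    eval-Free ρ (app f ts) = F-cong f (λ i → eval-Free ρ (ts i))

    Free-∈ : Free Q ∈ Q
    Free-∈ q q∈Q ρ ps = fromSubst {conclusion q} (F-ax q q∈Q ρ (All.map (λ {e} → toSubst {e}) ps))
      where
      toSubst : {e : Equation σ} → Holds (Free Q) ρ e →
                _≈F_ Q (substT ρ (proj₁ e)) (substT ρ (proj₂ e))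
      toSubst {s , t} p = F-trans (F-sym (eval-Free ρ s)) (F-trans p (eval-Free ρ t))

      fromSubst : {e : Equation σ} → _≈F_ Q (substT ρ (proj₁ e)) (substT ρ (proj₂ e)) →
                  Holds (Free Q) ρ e
      fromSubst {s , t} p = F-trans (eval-Free ρ s) (F-trans p (F-sym (eval-Free ρ t)))

  ×-finite : {A B : Algebra σ} → Finite A → Finite B → Finite (A ×A B)
  ×-finite {A} {B} (m , e , e-onto) (n , e′ , e′-onto) =
    m * n , enum , λ (a , b) → combine (proj₁ (e-onto a)) (proj₁ (e′-onto b)) , enum-onto a b
    where
    enum : Fin (m * n) → Carrier (A ×A B)
    enum = Product.map e e′ ∘ remQuot n

    enum-onto : ∀ a b → _≈_ (A ×A B) (enum (combine (proj₁ (e-onto a)) (proj₁ (e′-onto b)))) (a , b)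
    enum-onto a b = ≈-trans (A ×A B)
      (≈-reflexive (A ×A B) (≡.cong (Product.map e e′) (remQuot-combine (proj₁ (e-onto a)) (proj₁ (e′-onto b)))))
      (proj₂ (e-onto a) , proj₂ (e′-onto b))

-- Solutions of the diagram of A in B are exactly the homomorphisms A → B.
module Diagram {σ : Signature} (A : Algebra σ) (finite : Finite A) (_≟_ : Decidable (_≈_ A)) where

  n : ℕ
  n = proj₁ finite

  enum : Fin n → Carrier A
  enum = proj₁ (proj₂ finite)

  code : Carrier A → Fin n
  code a = proj₁ (proj₂ (proj₂ finite) a)

  enum-code : ∀ a → _≈_ A (enum (code a)) a
  enum-code a = proj₂ (proj₂ (proj₂ finite) a)

  x : Fin n → Term σ ℕ
  x i = var (toℕ i)

  opEquation : (f : Fin (nOps σ)) → (Fin (arity σ f) → Fin n) → Equation σ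
  opEquation f t = app f (x ∘ t) , x (code (op A f (enum ∘ t)))

  equalityPart : List (Equation σ)
  equalityPart = concat (tabulate λ i → concat (tabulate λ j → when (enum i ≟ enum j) (x i , x j)))

  -- finToFun enumerates all tuples Fin k → Fin n.
  operationPart : List (Equation σ)
  operationPart = concat (tabulate λ f → tabulate (opEquation f ∘ finToFun))

  diagram : List (Equation σ)
  diagram = equalityPart ++ operationPart

  assignment : {B : Algebra σ} → Hom A B → ℕ → Carrier B
  assignment {B} h = extend (⟦ h ⟧ ∘ enum) (inhabitant B)

  assignment-x : {B : Algebra σ} (h : Hom A B) (i : Fin n) → assignment h (toℕ i) ≡ ⟦ h ⟧ (enum i)
  assignment-x {B} h = extend-toℕ (⟦ h ⟧ ∘ enum) (inhabitant B)

  diagram-sound : {B : Algebra σ} (h : Hom A B) → All (Holds B (assignment h)) diagram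
  diagram-sound {B} h =
    ++⁺ (concat⁺ (tabulate⁺ λ i → concat⁺ (tabulate⁺ λ j → All-when⁺ (enum i ≟ enum j) (equalityHolds i j))))
        (concat⁺ (tabulate⁺ λ f → tabulate⁺ λ t → opHolds f (finToFun t)))
    where
    open SetoidReasoning (setoid B)

    ρ : ℕ → Carrier B
    ρ = assignment h

    equalityHolds : ∀ i j → _≈_ A (enum i) (enum j) → Holds B ρ (x i , x j)
    equalityHolds i j p = begin
      ρ (toℕ i)       ≡⟨ assignment-x h i ⟩
      ⟦ h ⟧ (enum i)  ≈⟨ ⟦⟧-cong h p ⟩
      ⟦ h ⟧ (enum j)  ≡⟨ assignment-x h j ⟨
      ρ (toℕ j)       ∎

    opHolds : ∀ f t → Holds B ρ (opEquation f t)
    opHolds f t = begin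
      op B f (ρ ∘ toℕ ∘ t)                   ≈⟨ op-cong B f (λ k → ≈-reflexive B (assignment-x h (t k))) ⟩
      op B f (⟦ h ⟧ ∘ enum ∘ t)              ≈⟨ ⟦⟧-homo h f (enum ∘ t) ⟨
      ⟦ h ⟧ (op A f (enum ∘ t))              ≈⟨ ⟦⟧-cong h (enum-code _) ⟨
      ⟦ h ⟧ (enum (code (op A f (enum ∘ t)))) ≡⟨ assignment-x h _ ⟨
      ρ (toℕ (code (op A f (enum ∘ t))))     ∎

  module _ {B : Algebra σ} (ρ : ℕ → Carrier B) (ρ⊨diagram : All (Holds B ρ) diagram) where

    private
      equalityHolds : ∀ i j → _≈_ A (enum i) (enum j) → Holds B ρ (x i , x j)
      equalityHolds i j =
        All-when⁻ (enum i ≟ enum j)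
          (tabulate⁻ (concat⁻ (tabulate⁻ (concat⁻ (++⁻ˡ equalityPart ρ⊨diagram)) i)) j)

      opHolds : ∀ f t → Holds B ρ (opEquation f (finToFun t))
      opHolds f = tabulate⁻ (tabulate⁻ (concat⁻ (++⁻ʳ equalityPart ρ⊨diagram)) f)

      ⟦_⟧ᵨ : Carrier A → Carrier B
      ⟦ a ⟧ᵨ = ρ (toℕ (code a))

      ⟦⟧ᵨ-cong : ∀ {a b} → _≈_ A a b → _≈_ B ⟦ a ⟧ᵨ ⟦ b ⟧ᵨ
      ⟦⟧ᵨ-cong {a} {b} p =
        equalityHolds (code a) (code b) (≈-trans A (enum-code a) (≈-trans A p (≈-sym A (enum-code b))))

      ⟦⟧ᵨ-homo : ∀ f xs → _≈_ B ⟦ op A f xs ⟧ᵨ (op B f (⟦_⟧ᵨ ∘ xs))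
      ⟦⟧ᵨ-homo f xs = begin
        ⟦ op A f xs ⟧ᵨ                 ≈⟨ ⟦⟧ᵨ-cong (op-cong A f enum-t≈xs) ⟨
        ⟦ op A f (enum ∘ t) ⟧ᵨ         ≈⟨ opHolds f (funToFin (code ∘ xs)) ⟨
        op B f (ρ ∘ toℕ ∘ t)           ≈⟨ op-cong B f (λ k → ≈-reflexive B (≡.cong (ρ ∘ toℕ) (t≗code∘xs k))) ⟩
        op B f (⟦_⟧ᵨ ∘ xs)             ∎
        where
        open SetoidReasoning (setoid B)

        t : Fin (arity σ f) → Fin n
        t = finToFun (funToFin (code ∘ xs))

        t≗code∘xs : ∀ k → t k ≡ code (xs k)
        t≗code∘xs = finToFun-funToFin (code ∘ xs)

        enum-t≈xs : ∀ k → _≈_ A (enum (t k)) (xs k)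
        enum-t≈xs k = ≈-trans A (≈-reflexive A (≡.cong enum (t≗code∘xs k))) (enum-code (xs k))

    diagram-hom : Hom A B
    diagram-hom = record { ⟦_⟧ = ⟦_⟧ᵨ ; ⟦⟧-cong = ⟦⟧ᵨ-cong ; ⟦⟧-homo = ⟦⟧ᵨ-homo }

module _ {σ : Signature} {Q : Quasivariety σ}
         (lem : ExcludedMiddle (lsuc 0ℓ)) (asc : AlmostStructurallyComplete Q) where

  separating-hom : (A : Algebra σ) → Finite A → A ∈ Q → Hom A (Free Q) →
                   ∀ {a b} → ¬ _≈_ A a b →
                   Σ (Hom A (Free Q)) λ h → ¬ _≈F_ Q (⟦ h ⟧ a) (⟦ h ⟧ b)
  separating-hom A finite A∈Q g {a} {b} a≉b =
    let (ρ , ρ⊨diagram , ρ⊭a≈b) = ¬⊨⇒counterexample lem (Free Q) q (λ F⊨q → Q⊭q (asc q F⊨q F⊭*q))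
    in  diagram-hom ρ ρ⊨diagram , ρ⊭a≈b
    where
    open Diagram A finite (λ a b → decide lem (_≈_ A a b))

    q : QuasiIdentity σ
    q = diagram ⇒ (x (code a) , x (code b))

    Q⊭q : ¬ (Q ⊫ q)
    Q⊭q Q⊫q = a≉b (begin
      a                                 ≈⟨ enum-code a ⟨
      enum (code a)                     ≡⟨ assignment-x idʰ (code a) ⟨
      assignment idʰ (toℕ (code a))     ≈⟨ Q⊫q A A∈Q (assignment idʰ) (diagram-sound idʰ) ⟩
      assignment idʰ (toℕ (code b))     ≡⟨ assignment-x idʰ (code b) ⟩
      enum (code b)                     ≈⟨ enum-code b ⟩
      b                                 ∎)
      where open SetoidReasoning (setoid A)

    F⊭*q : ¬ (Free Q ⊨* q)
    F⊭*q F⊨*q = F⊨*q (assignment g) (diagram-sound g)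

    counterexample = ¬⊨⇒counterexample lem (Free Q) q (λ F⊨q → Q⊭q (asc q F⊨q F⊭*q))
    ρ = proj₁ counterexample

record ProductKernel {σ : Signature} (Q : Quasivariety σ) (A C : Algebra σ) {B : Algebra σ}
                     (h : Hom (A ×A C) B) : Set₁ where
  field
    α : QCong Q A
    β : QCong Q C
    kernel⇒α×β : ∀ x y → _≈_ B (⟦ h ⟧ x) (⟦ h ⟧ y) →
                 rel (proj₁ α) (proj₁ x) (proj₁ y) × rel (proj₁ β) (proj₂ x) (proj₂ y)
    α×β⇒kernel : ∀ x y → rel (proj₁ α) (proj₁ x) (proj₁ y) × rel (proj₁ β) (proj₂ x) (proj₂ y) →
                 _≈_ B (⟦ h ⟧ x) (⟦ h ⟧ y)

module _ {σ : Signature} {Q : Quasivariety σ} {A C B : Algebra σ} where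

  fraserHorn-kernel : FraserHorn Q → B ∈ Q → (h : Hom (A ×A C) B) → ProductKernel Q A C h
  fraserHorn-kernel FH B∈Q h =
    let (α , β , α×β≡kernel) = FH A C (kernel h , kernel-∈ B∈Q h) in
    record
      { α          = α
      ; β          = β
      ; kernel⇒α×β = λ x y → proj₁ (α×β≡kernel x y)
      ; α×β⇒kernel = λ x y → proj₂ (α×β≡kernel x y)
      }

  module _ (h : Hom (A ×A C) B) (K : ProductKernel Q A C h) where
    open ProductKernel K

    ¬kernel⇒¬α : ∀ {a b c} → ¬ _≈_ B (⟦ h ⟧ (a , c)) (⟦ h ⟧ (b , c)) → ¬ rel (proj₁ α) a b
    ¬kernel⇒¬α h≉ aαb = h≉ (α×β⇒kernel _ _ (aαb , IsEquivalence.refl (Congruence.isEquiv (proj₁ β))))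

    equality×equality⇒embedding : IsEquality A (proj₁ α) → IsEquality C (proj₁ β) →
                                  Embedding (A ×A C) B
    equality×equality⇒embedding α-eq β-eq = record
      { map      = ⟦ h ⟧
      ; map-cong = ⟦⟧-cong h
      ; map-inj  = λ {x} {y} p → let (p₁ , p₂) = kernel⇒α×β x y p in
                     α-eq _ _ p₁ , β-eq _ _ p₂
      ; map-hom  = ⟦⟧-homo h
      }

    equality×total⇒embedding : IsEquality A (proj₁ α) → IsTotal C (proj₁ β) → Embedding A B
    equality×total⇒embedding α-eq β-total = record
      { map      = λ a → ⟦ h ⟧ (a , c₀)
      ; map-cong = λ p → ⟦⟧-cong h (p , ≈-refl C)
      ; map-inj  = λ {a} {b} p → α-eq a b (proj₁ (kernel⇒α×β (a , c₀) (b , c₀) p))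
      ; map-hom  = λ f xs →
          ≈-trans B (α×β⇒kernel (op A f xs , c₀) _ (α-refl , β-total c₀ _)) (⟦⟧-homo h f (λ i → xs i , c₀))
      }
      where
      c₀ : Carrier C
      c₀ = inhabitant C

      α-refl : ∀ {a} → rel (proj₁ α) a a
      α-refl = IsEquivalence.refl (Congruence.isEquiv (proj₁ α))

lemma6p3 : ExcludedMiddle (lsuc 0ℓ) →
    (σ : Signature) (Q : Quasivariety σ) →
    FraserHorn Q →
    (C : Subuniverse (Free Q)) → Finite (SubAlg (Free Q) C) → QSimple Q (SubAlg (Free Q) C) →
    AlmostStructurallyComplete Q →
    (S : Algebra σ) → Finite S → QSubdirectlyIrreducible Q S →
    Embedding S (Free Q) ⊎ Embedding (S ×A SubAlg (Free Q) C) (Free Q)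
lemma6p3 lem σ Q FH C C-finite (_ , C-simple) asc S S-finite (S∈Q , _ , S-irreducible) =
  let (k , αₖ-equality) = S-irreducible Separated α ⋂α⊆equality
      h = proj₁ (separate k)
      K = splitting k
  in [ inj₂ ∘ equality×equality⇒embedding h K αₖ-equality
     , inj₁ ∘ equality×total⇒embedding h K αₖ-equality
     ]′ (C-simple (ProductKernel.β K))
  where
  C′ : Algebra σ
  C′ = SubAlg (Free Q) C

  c₀ : Carrier C′
  c₀ = inhabitant C′

  Separated : Set
  Separated = Σ (Carrier S × Carrier S) λ (a , b) → ¬ _≈_ S a b

  separate : ((ab , _) : Separated) →
             Σ (Hom (S ×A C′) (Free Q)) λ h → ¬ _≈F_ Q (⟦ h ⟧ (proj₁ ab , c₀)) (⟦ h ⟧ (proj₂ ab , c₀))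
  separate ((a , b) , a≉b) =
    separating-hom lem asc (S ×A C′) (×-finite {A = S} {B = C′} S-finite C-finite)
                   (×-∈ {A = S} {B = C′} S∈Q (SubAlg-∈ C Free-∈))
                   (inclusionʰ C ∘ʰ proj₂ʰ {A = S}) {a , c₀} {b , c₀} (a≉b ∘ proj₁)

  splitting : (k : Separated) → ProductKernel Q S C′ (proj₁ (separate k))
  splitting k = fraserHorn-kernel FH Free-∈ (proj₁ (separate k))

  α : Separated → QCong Q S
  α = ProductKernel.α ∘ splitting

  ⋂α⊆equality : ∀ a b → (∀ k → rel (proj₁ (α k)) a b) → _≈_ S a b
  ⋂α⊆equality a b a⋂αb = ¬¬-elim lem λ a≉b →
    let k = (a , b) , a≉b in ¬kernel⇒¬α (proj₁ (separate k)) (splitting k) (proj₂ (separate k)) (a⋂αb k)
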